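{- Let $a\ge2$, $\ell\ge1$, $n=a+\ell-1$, $\mu=(a,1^{\ell-1})$, $\rho=(a-1,1^\ell)$. Then $\dim_{\mathbb{Q}}(\mathcal{H}_\mu\cap\mathcal{H}_\rho)\le\frac{n!}{2}$.
   Context: Let $\mathbb{Q}[X,Y]=\mathbb{Q}[x_1,\dots,x_n;y_1,\dots,y_n]$. For $\nu\vdash n$ with cells at coordinates $(p_1,q_1),\dots,(p_n,q_n)$ (row $p$, column $q$, indexed from $1$, French convention: row $1$ is the bottom row), let $\Delta_\nu=\det(x_i^{p_j-1}y_i^{q_j-1})_{i,j=1}^n$, $I_\nu=\{f: f(\partial/\partial X;\partial/\partial Y)\Delta_\nu=0\}$, and $\mathcal{H}_\nu=\mathbb{Q}[X,Y]/I_\nu$ (the Garsia–Haiman module). For a hook $\nu\vdash n$, a standard filling $S$ is a bijection from the cells of $\nu$ to $\{1,\dots,n\}$. A row inversion is a pair $(t,r)$ of entries of row $1$ with $t$ left of $r$ and $t>r$; a column inversion is a pair $(d,c)$ of entries of column $1$ with $d$ above $c$ and $d>c$. Let $\varphi_S=\prod_{(d,c)\text{ col. inv.}}x_d\prod_{(t,r)\text{ row inv.}}y_r$. It is known (Adin–Remmel–Roichman) that $\{\varphi_S\}$ over standard fillings of $\nu$ gives a basis of $\mathcal{H}_\nu$. Convention used by the paper for the intersection: each $\mathcal{H}_\nu$ ($\nu$ a hook) is regarded as the subspace of $\mathbb{Q}[X,Y]$ spanned by $\{\varphi_S: S\text{ a standard filling of }\nu\}$, and the intersection is taken in $\mathbb{Q}[X,Y]$.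 -}

module Defs where

open import Data.Nat using (ℕ; zero; suc)
open import Data.Bool using (Bool; true; false; if_then_else_; _∧_)
open import Data.Fin using (Fin; _<?_) renaming (_≟_ to _≟F_)
open import Data.List using (List; []; _∷_; _++_; foldr; map)
import Data.List as List
open import Data.List.Relation.Unary.Unique.Propositional using (Unique)
open import Data.Vec using (Vec; toList; tabulate)
open import Data.Product using (Σ; _×_; _,_; proj₁; proj₂)
open import Data.Rational using (ℚ; 0ℚ; _+_; _*_)
open import Relation.Nullary using (yes; no)
open import Relation.Nullary.Decidable using (⌊_⌋)
open import Relation.Binary.PropositionalEquality using (_≡_)
import Data.Vec.Properties as VecP
import Data.Product.Properties as ProdP
import Data.Nat as Nat

-- Monomials in Q[x_1..x_n; y_1..y_n]: a pair of exponent vectors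
-- (x-exponents, y-exponents).  Variable x_d / y_d is indexed by the
-- entry value d, encoded as Fin n (value d+1 ↦ index d).

Mon : ℕ → Set
Mon n = Vec ℕ n × Vec ℕ n

Mon-≟ : ∀ {n} (m m′ : Mon n) → Relation.Nullary.Dec (m ≡ m′)
Mon-≟ = ProdP.≡-dec (VecP.≡-dec Nat._≟_) (VecP.≡-dec Nat._≟_)

-- Polynomials with rational coefficients, given by their coefficient
-- function (all polynomials considered below lie in spans of finitely
-- many monomials, hence are genuinely finitely supported).
Poly : ℕ → Set
Poly n = Mon n → ℚ

-- Standard fillings of a hook with arm length α (cells of row 1 to the
-- right of the corner) and leg length β (cells of column 1 above the
-- corner), filled with the values Fin n.  Row 1 has α+1 cells, column 1
-- has β+1 cells; when n = α + β + 1 a filling with pairwise distinct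
-- entries is exactly a bijection cells → {1..n}.

record HookFilling (n α β : ℕ) : Set where
  field
    corner : Fin n
    arm    : Vec (Fin n) α   -- entries of cells (1,2),…,(1,α+1), left to right
    leg    : Vec (Fin n) β   -- entries of cells (2,1),…,(β+1,1), bottom to top
    distinct : Unique (corner ∷ toList arm ++ toList leg)

  row₁ : List (Fin n)
  row₁ = corner ∷ toList arm

  col₁ : List (Fin n)
  col₁ = corner ∷ toList leg

countᵇ : ∀ {A : Set} → (A → Bool) → List A → ℕ
countᵇ p [] = 0
countᵇ p (z ∷ zs) = (if p z then 1 else 0) Nat.+ countᵇ p zs

-- Exponent of x_v in ∏_{(d,c) column inversion} x_d, column listed
-- bottom to top: pairs (d,c) with d above c and d > c, counted at d.
colExp : ∀ {n} → List (Fin n) → Fin n → ℕ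
colExp [] v = 0
colExp (c ∷ rest) v =
  countᵇ (λ d → ⌊ d ≟F v ⌋ ∧ ⌊ c <? d ⌋) rest Nat.+ colExp rest v

-- Exponent of y_v in ∏_{(t,r) row inversion} y_r, row listed left to
-- right: pairs (t,r) with t left of r and t > r, counted at r.
rowExp : ∀ {n} → List (Fin n) → Fin n → ℕ
rowExp [] v = 0
rowExp (t ∷ rest) v =
  countᵇ (λ r → ⌊ r ≟F v ⌋ ∧ ⌊ r <? t ⌋) rest Nat.+ rowExp rest v

φ : ∀ {n α β} → HookFilling n α β → Mon n
φ S = tabulate (colExp (HookFilling.col₁ S)) , tabulate (rowExp (HookFilling.row₁ S))

sumℚ : List ℚ → ℚ
sumℚ = foldr _+_ 0ℚ

combo : ∀ {n α β} → List (ℚ × HookFilling n α β) → Poly n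
combo L m = sumℚ (map (λ cS → if ⌊ Mon-≟ (φ (proj₂ cS)) m ⌋ then proj₁ cS else 0ℚ) L)

-- f ∈ H_ν = span_Q { φ_S : S standard filling of the hook ν = (α+1, 1^β) }
InHook : (n α β : ℕ) → Poly n → Set
InHook n α β f = Σ (List (ℚ × HookFilling n α β)) λ L → ∀ m → f m ≡ combo L m

LinIndep : ∀ {n k} → (Fin k → Poly n) → Set
LinIndep {n} {k} p =
  (c : Fin k → ℚ) →
  (∀ m → sumℚ (List.tabulate (λ i → c i * p i m)) ≡ 0ℚ) →
  ∀ i → c i ≡ 0ℚ

-- An element of both spans is supported on monomials φ S = φ T with S a filling of μ and T one
-- of ρ.  Let c, …, t be the bottom row of S.  If t < c, every entry of that row above t lies
-- left of t and is counted in the exponent of y_t, which T bounds by the number of entries of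
-- its own row above t; every other entry lies right of the larger corner c, so it has a
-- positive y-exponent and hence occurs in the row of T.  The row of T would then be at least as
-- long as that of S, which it is not; so c < t.  Hence φ S is determined by the arrangement of
-- the n − 2 entries other than c and t (arm, then leg), there are at most n!/2 such monomials,
-- and independent polynomials supported on N monomials number at most N.
module Submission where

open import Defs
open import Data.Nat as Nat using (ℕ; zero; suc; _≤_; _<_; z≤n; s≤s; _∸_; _!; _/_)
import Data.Nat.Properties as ℕP
open import Data.Nat.DivMod using (m*n/n≡m)
open import Data.Bool using (Bool; true; false; if_then_else_; _∧_; not)
open import Data.Fin as Fin using (Fin; zero; suc; punchIn; _<?_) renaming (_≟_ to _≟F_)
import Data.Fin.Properties as FinP
open import Data.List as List
  using (List; []; _∷_; _++_; [_]; length; map; concatMap; filter; allFin; take; drop)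
import Data.List.Properties as ListP
open import Data.List.Membership.Propositional using (_∈_; _∉_; find; lose)
open import Data.List.Membership.Propositional.Properties
  using ( ∈-∃++; ∈-++⁺ˡ; ∈-++⁺ʳ; ∈-++⁻; ∈-filter⁺; ∈-filter⁻; ∈-allFin
        ; ∈-map⁺; ∈-map⁻; ∈-concatMap⁺; ∈-concatMap⁻)
open import Data.List.Membership.Propositional.Properties.WithK using (unique∧set⇒bag)
open import Data.List.Relation.Unary.Any using (here; there)
open import Data.List.Relation.Unary.All as All using ([]; _∷_)
import Data.List.Relation.Unary.All.Properties as AllP
open import Data.List.Relation.Unary.All.Properties using (¬Any⇒All¬; All¬⇒¬Any)
open import Data.List.Relation.Unary.AllPairs using ([]; _∷_)
open import Data.List.Relation.Unary.Unique.Propositional using (Unique)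
open import Data.List.Relation.Unary.Unique.Propositional.Properties
  using (Unique[x∷xs]⇒x∉xs; ++⁺; filter⁺; allFin⁺)
open import Data.List.Relation.Binary.BagAndSetEquality using (∼bag⇒↭)
open import Data.List.Relation.Binary.Permutation.Propositional.Properties using (↭-length)
open import Data.Vec as Vec using (Vec; tabulate; toList; _∷ʳ_)
import Data.Vec.Properties as VecP
open import Data.Rational as Rational using (ℚ; 0ℚ; 1ℚ; NonZero; ≢-nonZero) renaming (_≟_ to _≟ℚ_)
open import Data.Rational.Properties using (+-*-commutativeRing; *-inverseʳ; *-zeroʳ; +-identityˡ)
open import Algebra.Bundles using (CommutativeRing)
open import Algebra.Properties.Semiring.Sum (CommutativeRing.semiring +-*-commutativeRing)
  using (sum; sum-cong-≗; sum-remove; sum-replicate-zero; ∑-distrib-+; *-distribˡ-sum)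
open import Tactic.RingSolver using (solve-∀)
open import Tactic.RingSolver.Core.AlmostCommutativeRing using (fromCommutativeRing)
open import Data.Product using (_×_; _,_; proj₁; proj₂; ∃)
open import Data.Sum using (inj₁; inj₂)
open import Data.Empty using (⊥-elim)
open import Function using (_∘_; _⇔_; mk⇔; case_of_)
open import Relation.Nullary using (¬_; Dec; yes; no; ¬?)
open import Relation.Nullary.Decidable using (⌊_⌋; dec⇒maybe; decidable-stable; dec-true; isYes≗does)
open import Relation.Binary using (tri<; tri≈; tri>)
open import Relation.Binary.PropositionalEquality
  using (_≡_; refl; sym; trans; cong; cong₂; subst; subst₂; module ≡-Reasoning)

-- Linear independence and supports

Supported : ∀ {n} → List (Mon n) → Poly n → Set
Supported M f = ∀ m → ¬ f m ≡ 0ℚ → m ∈ M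

-- ℚ arithmetic is in scope only inside this block; everywhere else _+_ and _*_ are ℕ's.
module _ where

  open Rational using (_+_; _*_; -_; _-_; 1/_)

  private
    ℚ-ring = fromCommutativeRing +-*-commutativeRing λ x → dec⇒maybe (0ℚ ≟ℚ x)

  sumℚ-tabulate : ∀ {k} (f : Fin k → ℚ) → sumℚ (List.tabulate f) ≡ sum f
  sumℚ-tabulate {zero} f = refl
  sumℚ-tabulate {suc k} f = cong (f zero +_) (sumℚ-tabulate (f ∘ suc))

  sum-linear : ∀ {k} (d x y : Fin k → ℚ) (s : ℚ) →
               sum (λ j → d j * (x j - y j * s)) ≡ sum (λ j → d j * x j) - sum (λ j → d j * y j) * s
  sum-linear d x y s = begin
    sum (λ j → d j * (x j - y j * s))   ≡⟨ sum-cong-≗ (λ j → split (d j) (x j) (y j) s) ⟩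
    sum (λ j → dx j + (- s) * dy j)     ≡⟨ ∑-distrib-+ dx (λ j → (- s) * dy j) ⟩
    sum dx + sum (λ j → (- s) * dy j)   ≡⟨ cong (sum dx +_) (sym (*-distribˡ-sum (- s) dy)) ⟩
    sum dx + (- s) * sum dy             ≡⟨ regroup (sum dx) (sum dy) s ⟩
    sum dx - sum dy * s                 ∎
    where
    open ≡-Reasoning
    dx dy : Fin _ → ℚ
    dx j = d j * x j
    dy j = d j * y j
    split : ∀ d x y s → d * (x - y * s) ≡ d * x + (- s) * (d * y)
    split = solve-∀ ℚ-ring
    regroup : ∀ X Y s → X + (- s) * Y ≡ X - Y * s
    regroup = solve-∀ ℚ-ring

  module _ {n : ℕ} where

    Supported-[]⁻ : ∀ {f : Poly n} → Supported [] f → ∀ m → f m ≡ 0ℚ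
    Supported-[]⁻ {f} supp m = decidable-stable (f m ≟ℚ 0ℚ) (λ f≢0 → case supp m f≢0 of λ ())

    Supported-∷⁻ : ∀ {m₀ M} {f : Poly n} → Supported (m₀ ∷ M) f → f m₀ ≡ 0ℚ → Supported M f
    Supported-∷⁻ supp f≡0 m f≢0 with supp m f≢0
    ... | here refl = ⊥-elim (f≢0 f≡0)
    ... | there m∈M = m∈M

    Supported-sub-scaled : ∀ {M} {f g : Poly n} (c : ℚ) → Supported M f → Supported M g →
                           Supported M (λ m → f m - c * g m)
    Supported-sub-scaled {f = f} {g} c suppf suppg m h with f m ≟ℚ 0ℚ | g m ≟ℚ 0ℚ
    ... | no f≢0  | _       = suppf m f≢0
    ... | yes _   | no g≢0  = suppg m g≢0
    ... | yes f≡0 | yes g≡0 = ⊥-elim (h (trans (cong₂ (λ u v → u - c * v) f≡0 g≡0) (zero-sub c)))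
      where
      zero-sub : ∀ c → 0ℚ - c * 0ℚ ≡ 0ℚ
      zero-sub = solve-∀ ℚ-ring

  module Elimination {n k} (p : Fin (suc k) → Poly n) (i₀ : Fin (suc k)) (m₀ : Mon n)
                     (pivot≢0 : ¬ p i₀ m₀ ≡ 0ℚ) where

    instance
      pivot-nonZero : NonZero (p i₀ m₀)
      pivot-nonZero = ≢-nonZero pivot≢0

    multiplier : Fin k → ℚ
    multiplier j = p (punchIn i₀ j) m₀ * 1/ p i₀ m₀

    reduced : Fin k → Poly n
    reduced j m = p (punchIn i₀ j) m - multiplier j * p i₀ m

    reduced-vanishes : ∀ j → reduced j m₀ ≡ 0ℚ
    reduced-vanishes j = begin
      b - (b * 1/ a) * a  ≡⟨ reassoc b (1/ a) a ⟩
      b - b * (a * 1/ a)  ≡⟨ cong (λ z → b - b * z) (*-inverseʳ a) ⟩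
      b - b * 1ℚ          ≡⟨ cancel b ⟩
      0ℚ                  ∎
      where
      open ≡-Reasoning
      a = p i₀ m₀
      b = p (punchIn i₀ j) m₀
      reassoc : ∀ b c a → b - (b * c) * a ≡ b - b * (a * c)
      reassoc = solve-∀ ℚ-ring
      cancel : ∀ b → b - b * 1ℚ ≡ 0ℚ
      cancel = solve-∀ ℚ-ring

    reduced-supported : ∀ {M} → (∀ i → Supported (m₀ ∷ M) (p i)) → ∀ j → Supported M (reduced j)
    reduced-supported supp j =
      Supported-∷⁻ (Supported-sub-scaled (multiplier j) (supp (punchIn i₀ j)) (supp i₀)) (reduced-vanishes j)

    -- A relation d among the reduced family is the relation of p whose coefficient is
    -- d j at punchIn i₀ j and − Σ d j · multiplier j at the pivot i₀.
    reduced-linIndep : LinIndep p → LinIndep reduced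
    reduced-linIndep indep d Σd≡0 j = begin
      d j                   ≡⟨ sym (coeff-punchIn j) ⟩
      coeff (punchIn i₀ j)  ≡⟨ indep coeff Σcoeff≡0 (punchIn i₀ j) ⟩
      0ℚ                    ∎
      where
      open ≡-Reasoning
      B : ℚ
      B = sum (λ j → d j * multiplier j)
      coeff : Fin (suc k) → ℚ
      coeff = Vec.lookup (Vec.insertAt (tabulate d) i₀ (- B))
      coeff-punchIn : ∀ j → coeff (punchIn i₀ j) ≡ d j
      coeff-punchIn j = trans (VecP.insertAt-punchIn (tabulate d) i₀ (- B) j) (VecP.lookup∘tabulate d j)
      swap : ∀ B r S → (- B) * r + S ≡ S - B * r
      swap = solve-∀ ℚ-ring
      Σcoeff≡0 : ∀ m → sumℚ (List.tabulate (λ i → coeff i * p i m)) ≡ 0ℚ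
      Σcoeff≡0 m = begin
        sumℚ (List.tabulate (λ i → coeff i * p i m))
          ≡⟨ sumℚ-tabulate (λ i → coeff i * p i m) ⟩
        sum (λ i → coeff i * p i m)
          ≡⟨ sum-remove {i = i₀} (λ i → coeff i * p i m) ⟩
        coeff i₀ * p i₀ m + sum (λ j → coeff (punchIn i₀ j) * p (punchIn i₀ j) m)
          ≡⟨ cong₂ (λ c s → c * p i₀ m + s) (VecP.insertAt-lookup (tabulate d) i₀ (- B))
                   (sum-cong-≗ (λ j → cong (_* p (punchIn i₀ j) m) (coeff-punchIn j))) ⟩
        (- B) * p i₀ m + sum (λ j → d j * p (punchIn i₀ j) m)
          ≡⟨ swap B (p i₀ m) (sum (λ j → d j * p (punchIn i₀ j) m)) ⟩
        sum (λ j → d j * p (punchIn i₀ j) m) - B * p i₀ m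
          ≡⟨ sym (sum-linear d (λ j → p (punchIn i₀ j) m) multiplier (p i₀ m)) ⟩
        sum (λ j → d j * reduced j m)
          ≡⟨ sym (sumℚ-tabulate (λ j → d j * reduced j m)) ⟩
        sumℚ (List.tabulate (λ j → d j * reduced j m))
          ≡⟨ Σd≡0 m ⟩
        0ℚ ∎

  linIndep⇒≤length : ∀ {n k} (M : List (Mon n)) (p : Fin k → Poly n) →
                     LinIndep p → (∀ i → Supported M (p i)) → k ≤ length M
  linIndep⇒≤length {k = zero} M p _ _ = z≤n
  linIndep⇒≤length {k = suc k} [] p indep supp = case indep (λ _ → 1ℚ) all-ones-relation zero of λ ()
    where
    all-ones-relation : ∀ m → sumℚ (List.tabulate (λ i → 1ℚ * p i m)) ≡ 0ℚ
    all-ones-relation m = begin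
      sumℚ (List.tabulate (λ i → 1ℚ * p i m))
        ≡⟨ sumℚ-tabulate (λ i → 1ℚ * p i m) ⟩
      sum (λ i → 1ℚ * p i m)
        ≡⟨ sum-cong-≗ (λ i → trans (cong (1ℚ *_) (Supported-[]⁻ (supp i) m)) (*-zeroʳ 1ℚ)) ⟩
      sum {suc k} (λ _ → 0ℚ)
        ≡⟨ sum-replicate-zero (suc k) ⟩
      0ℚ ∎
      where open ≡-Reasoning
  linIndep⇒≤length {k = suc k} (m₀ ∷ M) p indep supp with FinP.any? (λ i → ¬? (p i m₀ ≟ℚ 0ℚ))
  ... | yes (i₀ , pivot≢0) =
    s≤s (linIndep⇒≤length M reduced (reduced-linIndep indep) (reduced-supported supp))
    where open Elimination p i₀ m₀ pivot≢0
  ... | no no-pivot =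
    ℕP.m≤n⇒m≤1+n (linIndep⇒≤length M p indep λ i → Supported-∷⁻ (supp i) (vanishes i))
    where
    vanishes : ∀ i → p i m₀ ≡ 0ℚ
    vanishes i = decidable-stable (p i m₀ ≟ℚ 0ℚ) (λ pᵢm₀≢0 → no-pivot (i , pᵢm₀≢0))

open Nat using (_+_; _*_)

isYes-true : ∀ {P : Set} (P? : Dec P) → P → ⌊ P? ⌋ ≡ true
isYes-true P? p = trans (isYes≗does P?) (dec-true P? p)

module _ {A : Set} (p : A → Bool) where

  countᵇ-++ : ∀ xs ys → countᵇ p (xs ++ ys) ≡ countᵇ p xs + countᵇ p ys
  countᵇ-++ [] ys = refl
  countᵇ-++ (x ∷ xs) ys =
    trans (cong (_ +_) (countᵇ-++ xs ys)) (sym (ℕP.+-assoc (if p x then 1 else 0) _ _))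

  countᵇ+countᵇ-not : ∀ xs → countᵇ p xs + countᵇ (not ∘ p) xs ≡ length xs
  countᵇ+countᵇ-not [] = refl
  countᵇ+countᵇ-not (x ∷ xs) with p x
  ... | true  = cong suc (countᵇ+countᵇ-not xs)
  ... | false = trans (ℕP.+-suc (countᵇ p xs) _) (cong suc (countᵇ+countᵇ-not xs))

  countᵇ-∷-true : ∀ {x} xs → p x ≡ true → countᵇ p (x ∷ xs) ≡ suc (countᵇ p xs)
  countᵇ-∷-true xs px rewrite px = refl

  countᵇ-∈ : ∀ {x xs} → x ∈ xs → p x ≡ true → 1 ≤ countᵇ p xs
  countᵇ-∈ {xs = y ∷ ys} (here refl) px rewrite px = s≤s z≤n
  countᵇ-∈ {xs = y ∷ ys} (there x∈ys) px = ℕP.≤-trans (countᵇ-∈ x∈ys px) (ℕP.m≤n+m _ _)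

  countᵇ-none : ∀ xs → (∀ {x} → x ∈ xs → p x ≡ false) → countᵇ p xs ≡ 0
  countᵇ-none [] _ = refl
  countᵇ-none (x ∷ xs) none rewrite none (here refl) = countᵇ-none xs (none ∘ there)

  countᵇ-mono : ∀ {xs} ys → Unique xs → (∀ {x} → x ∈ xs → p x ≡ true → x ∈ ys) →
                countᵇ p xs ≤ countᵇ p ys
  countᵇ-mono {[]} ys _ _ = z≤n
  countᵇ-mono {x ∷ xs} ys (x∉xs ∷ uxs) ⊆ys with p x in px
  ... | false = countᵇ-mono ys uxs (⊆ys ∘ there)
  ... | true with ∈-∃++ (⊆ys (here refl) px)
  ...   | ys₁ , ys₂ , refl = begin
    suc (countᵇ p xs)                  ≤⟨ s≤s (countᵇ-mono (ys₁ ++ ys₂) uxs ⊆ys₁₂) ⟩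
    suc (countᵇ p (ys₁ ++ ys₂))        ≡⟨ cong suc (countᵇ-++ ys₁ ys₂) ⟩
    suc (countᵇ p ys₁ + countᵇ p ys₂)  ≡⟨ sym (ℕP.+-suc (countᵇ p ys₁) _) ⟩
    countᵇ p ys₁ + suc (countᵇ p ys₂)  ≡⟨ cong (countᵇ p ys₁ +_) (sym (countᵇ-∷-true ys₂ px)) ⟩
    countᵇ p ys₁ + countᵇ p (x ∷ ys₂)  ≡⟨ sym (countᵇ-++ ys₁ (x ∷ ys₂)) ⟩
    countᵇ p (ys₁ ++ x ∷ ys₂)          ∎
    where
    open ℕP.≤-Reasoning
    ⊆ys₁₂ : ∀ {y} → y ∈ xs → p y ≡ true → y ∈ ys₁ ++ ys₂
    ⊆ys₁₂ {y} y∈xs py with ∈-++⁻ ys₁ (⊆ys (there y∈xs) py)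
    ... | inj₁ y∈ys₁         = ∈-++⁺ˡ y∈ys₁
    ... | inj₂ (here refl)   = ⊥-elim (All.lookup x∉xs y∈xs refl)
    ... | inj₂ (there y∈ys₂) = ∈-++⁺ʳ ys₁ y∈ys₂

-- Row exponents

module _ {n : ℕ} where

  open import Data.List.Membership.DecPropositional (_≟F_ {n}) using (_∈?_)

  above : Fin n → Fin n → Bool
  above t u = ⌊ t <? u ⌋

  countᵇ-≡-∉ : ∀ {v} (q : Fin n → Bool) {ys} → v ∉ ys →
               countᵇ (λ r → ⌊ r ≟F v ⌋ ∧ q r) ys ≡ 0
  countᵇ-≡-∉ {v} q {ys} v∉ys = countᵇ-none _ ys absent
    where
    absent : ∀ {r} → r ∈ ys → ⌊ r ≟F v ⌋ ∧ q r ≡ false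
    absent {r} r∈ys with r ≟F v
    ... | yes refl = ⊥-elim (v∉ys r∈ys)
    ... | no _     = refl

  countᵇ-≡-unique : ∀ {v} (q : Fin n → Bool) {ys} → Unique ys →
                    countᵇ (λ r → ⌊ r ≟F v ⌋ ∧ q r) ys ≤ (if q v then 1 else 0)
  countᵇ-≡-unique q {[]} _ = z≤n
  countᵇ-≡-unique {v} q {y ∷ ys} (y∉ys ∷ uys) with y ≟F v
  ... | no _ = countᵇ-≡-unique q uys
  ... | yes refl rewrite countᵇ-≡-∉ q (Unique[x∷xs]⇒x∉xs (y∉ys ∷ uys)) =
    ℕP.≤-reflexive (ℕP.+-identityʳ _)

  countᵇ-≡-∈ : ∀ {v} (q : Fin n → Bool) {ys} → v ∈ ys → q v ≡ true →
               1 ≤ countᵇ (λ r → ⌊ r ≟F v ⌋ ∧ q r) ys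
  countᵇ-≡-∈ {v} q v∈ys qv = countᵇ-∈ _ v∈ys (cong₂ _∧_ (isYes-true (v ≟F v) refl) qv)

  rowExp-∉ : ∀ {v} R → v ∉ R → rowExp R v ≡ 0
  rowExp-∉ [] _ = refl
  rowExp-∉ (x ∷ rest) v∉R = cong₂ _+_ (countᵇ-≡-∉ _ (v∉R ∘ there)) (rowExp-∉ rest (v∉R ∘ there))

  rowExp-pos⇒∈ : ∀ {v} R → 1 ≤ rowExp R v → v ∈ R
  rowExp-pos⇒∈ {v} R pos = decidable-stable (v ∈? R) λ v∉R → ℕP.<-irrefl (sym (rowExp-∉ R v∉R)) pos

  rowExp-∷-pos : ∀ {v x} rest → v ∈ rest → v Fin.< x → 1 ≤ rowExp (x ∷ rest) v
  rowExp-∷-pos {v} {x} rest v∈rest v<x =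
    ℕP.≤-trans (countᵇ-≡-∈ (λ r → ⌊ r <? x ⌋) v∈rest (isYes-true (v <? x) v<x)) (ℕP.m≤m+n _ _)

  rowExp≤countᵇ-above : ∀ t R → Unique R → rowExp R t ≤ countᵇ (above t) R
  rowExp≤countᵇ-above t [] _ = z≤n
  rowExp≤countᵇ-above t (x ∷ rest) (_ ∷ urest) =
    ℕP.+-mono-≤ (countᵇ-≡-unique (λ r → ⌊ r <? x ⌋) urest) (rowExp≤countᵇ-above t rest urest)

  countᵇ-above≤rowExp-last : ∀ t xs → countᵇ (above t) (xs ++ [ t ]) ≤ rowExp (xs ++ [ t ]) t
  countᵇ-above≤rowExp-last t [] with t <? t
  ... | yes t<t = ⊥-elim (FinP.<-irrefl refl t<t)
  ... | no _    = z≤n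
  countᵇ-above≤rowExp-last t (x ∷ xs) = ℕP.+-mono-≤ head-term (countᵇ-above≤rowExp-last t xs)
    where
    head-term : (if above t x then 1 else 0) ≤ countᵇ (λ r → ⌊ r ≟F t ⌋ ∧ ⌊ r <? x ⌋) (xs ++ [ t ])
    head-term with t <? x in t<?x
    ... | yes _ = countᵇ-≡-∈ (λ r → ⌊ r <? x ⌋) (∈-++⁺ʳ xs (here refl)) (cong ⌊_⌋ t<?x)
    ... | no _  = z≤n

  length-row≤ : ∀ {c t : Fin n} A R → Unique (c ∷ A ++ [ t ]) → Unique R →
                (∀ v → rowExp (c ∷ A ++ [ t ]) v ≡ rowExp R v) → t Fin.< c →
                length (c ∷ A ++ [ t ]) ≤ length R
  length-row≤ {c} {t} A R uS uR rowExp≗ t<c = begin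
    length S                                           ≡⟨ sym (countᵇ+countᵇ-not (above t) S) ⟩
    countᵇ (above t) S + countᵇ (not ∘ above t) S      ≤⟨ ℕP.+-mono-≤ above-bound below-bound ⟩
    countᵇ (above t) R + countᵇ (not ∘ above t) R      ≡⟨ countᵇ+countᵇ-not (above t) R ⟩
    length R                                           ∎
    where
    open ℕP.≤-Reasoning
    S = c ∷ A ++ [ t ]
    above-bound : countᵇ (above t) S ≤ countᵇ (above t) R
    above-bound = ℕP.≤-trans (countᵇ-above≤rowExp-last t (c ∷ A))
                    (ℕP.≤-trans (ℕP.≤-reflexive (rowExp≗ t)) (rowExp≤countᵇ-above t R uR))
    below-∈R : ∀ {u} → u ∈ S → not (above t u) ≡ true → u ∈ R
    below-∈R {u} _ _ with t <? u
    below-∈R (here refl)     _ | no t≮c = ⊥-elim (t≮c t<c)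
    below-∈R (there u∈rest)  _ | no t≮u =
      rowExp-pos⇒∈ R (subst (1 ≤_) (rowExp≗ _)
        (rowExp-∷-pos (A ++ [ t ]) u∈rest (ℕP.≤-<-trans (ℕP.≮⇒≥ t≮u) t<c)))
    below-bound : countᵇ (not ∘ above t) S ≤ countᵇ (not ∘ above t) R
    below-bound = countᵇ-mono (not ∘ above t) R uS below-∈R

  row-first<last : ∀ {c t : Fin n} A R → Unique (c ∷ A ++ [ t ]) → Unique R →
                   (∀ v → rowExp (c ∷ A ++ [ t ]) v ≡ rowExp R v) →
                   length R < length (c ∷ A ++ [ t ]) → c Fin.< t
  row-first<last {c} {t} A R uS@(c≢ ∷ _) uR rowExp≗ shorter with FinP.<-cmp c t
  ... | tri< c<t _ _ = c<t
  ... | tri≈ _ c≡t _ = ⊥-elim (All.lookup c≢ (∈-++⁺ʳ A (here refl)) c≡t)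
  ... | tri> _ _ t<c = ⊥-elim (ℕP.<⇒≱ shorter (length-row≤ A R uS uR rowExp≗ t<c))

-- Arrangements

module _ {A : Set} where

  length-concatMap-const : ∀ {B : Set} (f : A → List B) (c : ℕ) xs →
                           (∀ {x} → x ∈ xs → length (f x) ≡ c) → length (concatMap f xs) ≡ length xs * c
  length-concatMap-const f c [] _ = refl
  length-concatMap-const f c (x ∷ xs) lengths = begin
    length (f x ++ concatMap f xs)          ≡⟨ ListP.length-++ (f x) ⟩
    length (f x) + length (concatMap f xs)  ≡⟨ cong₂ _+_ (lengths (here refl))
                                                 (length-concatMap-const f c xs (lengths ∘ there)) ⟩
    c + length xs * c                       ∎
    where open ≡-Reasoning

  length-concatMap≤ : ∀ {B : Set} (f : A → List B) xs → (∀ x → length (f x) ≤ 1) →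
                      length (concatMap f xs) ≤ length xs
  length-concatMap≤ f [] _ = z≤n
  length-concatMap≤ f (x ∷ xs) ≤1 =
    ℕP.≤-trans (ℕP.≤-reflexive (ListP.length-++ (f x)))
               (ℕP.+-mono-≤ (≤1 x) (length-concatMap≤ f xs ≤1))

module _ {n : ℕ} where

  open import Data.List.Membership.DecPropositional (_≟F_ {n}) using (_∈?_; _∉?_)

  complement : List (Fin n) → List (Fin n)
  complement s = filter (_∉? s) (allFin n)

  ∈-complement⁺ : ∀ {x s} → x ∉ s → x ∈ complement s
  ∈-complement⁺ {x} {s} = ∈-filter⁺ (_∉? s) {xs = allFin n} (∈-allFin x)

  ∈-complement⁻ : ∀ {x s} → x ∈ complement s → x ∉ s
  ∈-complement⁻ {s = s} x∈s̄ = proj₂ (∈-filter⁻ (_∉? s) {xs = allFin n} x∈s̄)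

  length-complement : ∀ s → Unique s → length (complement s) ≡ n ∸ length s
  length-complement s us = begin
    length (complement s)                        ≡⟨ sym (ℕP.m+n∸m≡n (length s) _) ⟩
    length s + length (complement s) ∸ length s  ≡⟨ cong (_∸ length s) (sym (ListP.length-++ s)) ⟩
    length (s ++ complement s) ∸ length s        ≡⟨ cong (_∸ length s) (↭-length s++s̄↭allFin) ⟩
    length (allFin n) ∸ length s                 ≡⟨ cong (_∸ length s) (ListP.length-tabulate (λ i → i)) ⟩
    n ∸ length s                                 ∎
    where
    open ≡-Reasoning
    unique : Unique (s ++ complement s)
    unique = ++⁺ us (filter⁺ (_∉? s) {allFin n} (allFin⁺ n))
                 λ (x∈s , x∈s̄) → ∈-complement⁻ x∈s̄ x∈s
    ∈-s++s̄ : ∀ x → x ∈ s ++ complement s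
    ∈-s++s̄ x with x ∈? s
    ... | yes x∈s = ∈-++⁺ˡ x∈s
    ... | no x∉s  = ∈-++⁺ʳ s (∈-complement⁺ x∉s)
    same-elements : ∀ {x} → x ∈ s ++ complement s ⇔ x ∈ allFin n
    same-elements {x} = mk⇔ (λ _ → ∈-allFin x) (λ _ → ∈-s++s̄ x)
    s++s̄↭allFin = ∼bag⇒↭ (unique∧set⇒bag unique (allFin⁺ n) same-elements)

  extensions : List (Fin n) → List (List (Fin n))
  extensions s = map (_∷ s) (complement s)

  arrangements : ℕ → List (List (Fin n))
  arrangements zero = [ [] ]
  arrangements (suc j) = concatMap extensions (arrangements j)

  ∈-arrangements⁻ : ∀ {j s} → s ∈ arrangements j → Unique s × length s ≡ j
  ∈-arrangements⁻ {zero} (here refl) = [] , refl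
  ∈-arrangements⁻ {suc j} s∈ with find (∈-concatMap⁻ extensions {xs = arrangements j} s∈)
  ... | s′ , s′∈ , s∈ext with ∈-map⁻ (_∷ s′) s∈ext | ∈-arrangements⁻ {j} s′∈
  ...   | x , x∈s̄′ , refl | us′ , refl = ¬Any⇒All¬ s′ (∈-complement⁻ x∈s̄′) ∷ us′ , refl

  ∈-arrangements⁺ : ∀ {s} → Unique s → s ∈ arrangements (length s)
  ∈-arrangements⁺ {[]} _ = here refl
  ∈-arrangements⁺ {x ∷ s} (x∉s ∷ us) =
    ∈-concatMap⁺ extensions
      (lose (∈-arrangements⁺ us) (∈-map⁺ (_∷ s) (∈-complement⁺ (All¬⇒¬Any x∉s))))

  length-arrangements : ∀ j → j ≤ n → length (arrangements j) * (n ∸ j) ! ≡ n !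
  length-arrangements zero _ = ℕP.*-identityˡ (n !)
  length-arrangements (suc j) j<n = begin
    length (concatMap extensions Aⱼ) * (n ∸ suc j) !
      ≡⟨ cong (_* (n ∸ suc j) !) (length-concatMap-const extensions (n ∸ j) Aⱼ length-extensions) ⟩
    length Aⱼ * (n ∸ j) * (n ∸ suc j) !
      ≡⟨ ℕP.*-assoc (length Aⱼ) (n ∸ j) _ ⟩
    length Aⱼ * ((n ∸ j) * (n ∸ suc j) !)
      ≡⟨ cong (length Aⱼ *_) (sym factorial-step) ⟩
    length Aⱼ * (n ∸ j) !
      ≡⟨ length-arrangements j (ℕP.<⇒≤ j<n) ⟩
    n ! ∎
    where
    open ≡-Reasoning
    Aⱼ = arrangements j
    factorial-step : (n ∸ j) ! ≡ (n ∸ j) * (n ∸ suc j) !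
    factorial-step rewrite ℕP.+-∸-assoc 1 j<n = refl
    length-extensions : ∀ {s} → s ∈ Aⱼ → length (extensions s) ≡ n ∸ j
    length-extensions {s} s∈ with ∈-arrangements⁻ {j} s∈
    ... | us , refl = trans (ListP.length-map (_∷ s) (complement s)) (length-complement s us)

  length-arrangements-∸2 : ∀ j → n ∸ j ≡ 2 → n ! / 2 ≡ length (arrangements j)
  length-arrangements-∸2 j n∸j≡2 = begin
    n ! / 2                    ≡⟨ cong (_/ 2) (sym (length-arrangements j j≤n)) ⟩
    length Aⱼ * (n ∸ j) ! / 2  ≡⟨ cong (λ m → length Aⱼ * m ! / 2) n∸j≡2 ⟩
    length Aⱼ * 2 / 2          ≡⟨ m*n/n≡m (length Aⱼ) 2 ⟩
    length Aⱼ                  ∎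
    where
    open ≡-Reasoning
    Aⱼ = arrangements j
    j≤n : j ≤ n
    j≤n = ℕP.<⇒≤ (ℕP.m∸n≢0⇒n<m λ n∸j≡0 → case trans (sym n∸j≡2) n∸j≡0 of λ ())

-- Monomials shared by the two hooks

module _ {A : Set} where

  take-length-++ : ∀ (xs ys : List A) → take (length xs) (xs ++ ys) ≡ xs
  take-length-++ [] ys = refl
  take-length-++ (x ∷ xs) ys = cong (x ∷_) (take-length-++ xs ys)

  drop-length-++ : ∀ (xs ys : List A) → drop (length xs) (xs ++ ys) ≡ ys
  drop-length-++ [] ys = refl
  drop-length-++ (x ∷ xs) ys = drop-length-++ xs ys

  Unique-++⁻ˡ : ∀ xs {ys : List A} → Unique (xs ++ ys) → Unique xs
  Unique-++⁻ˡ [] _ = []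
  Unique-++⁻ˡ (x ∷ xs) (x∉ ∷ u) = AllP.++⁻ˡ xs x∉ ∷ Unique-++⁻ˡ xs u

  Unique-middle⁻ : ∀ xs {y} {ys : List A} → Unique (xs ++ y ∷ ys) → y ∉ xs ++ ys × Unique (xs ++ ys)
  Unique-middle⁻ [] (y∉ys ∷ uys) = All¬⇒¬Any y∉ys , uys
  Unique-middle⁻ (x ∷ xs) {y} {ys} (x∉ ∷ u) with Unique-middle⁻ xs u | AllP.++⁻ xs x∉
  ... | y∉ , uxsys | x∉xs , x≢y ∷ x∉ys = y∉x∷ , AllP.++⁺ x∉xs x∉ys ∷ uxsys
    where
    y∉x∷ : y ∉ x ∷ xs ++ ys
    y∉x∷ (here refl) = x≢y refl
    y∉x∷ (there y∈)  = y∉ y∈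

  tabulate-injective : ∀ {k} {f g : Fin k → A} → tabulate f ≡ tabulate g → ∀ i → f i ≡ g i
  tabulate-injective {f = f} {g} eq i = begin
    f i                        ≡⟨ sym (VecP.lookup∘tabulate f i) ⟩
    Vec.lookup (tabulate f) i  ≡⟨ cong (λ v → Vec.lookup v i) eq ⟩
    Vec.lookup (tabulate g) i  ≡⟨ VecP.lookup∘tabulate g i ⟩
    g i                        ∎
    where open ≡-Reasoning

module _ {n : ℕ} where

  hookMonomial : (c t : Fin n) (Y L : List (Fin n)) → Mon n
  hookMonomial c t Y L = tabulate (colExp (c ∷ L)) , tabulate (rowExp (c ∷ Y ++ [ t ]))

  φ-∷ʳ : ∀ {α β} c (ys : Vec (Fin n) α) t (leg : Vec (Fin n) β) d →
         φ (record { corner = c ; arm = ys ∷ʳ t ; leg = leg ; distinct = d })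
           ≡ hookMonomial c t (toList ys) (toList leg)
  φ-∷ʳ c ys t leg d =
    cong (λ A → tabulate (colExp (c ∷ toList leg)) , tabulate (rowExp (c ∷ A))) (VecP.toList-∷ʳ t ys)

  pairMonomial : ℕ → List (Fin n) → List (Fin n) → List (Mon n)
  pairMonomial a′ s (u ∷ v ∷ []) =
    [ (if ⌊ u <? v ⌋ then hookMonomial u v (take a′ s) (drop a′ s)
                     else hookMonomial v u (take a′ s) (drop a′ s)) ]
  pairMonomial a′ s _ = []

  ∈-pairMonomial : ∀ a′ s {c t} K → c ∈ K → t ∈ K → length K ≡ 2 → c Fin.< t →
                   hookMonomial c t (take a′ s) (drop a′ s) ∈ pairMonomial a′ s K
  ∈-pairMonomial a′ s (u ∷ v ∷ []) (here refl) (here refl) _ u<u = ⊥-elim (FinP.<-irrefl refl u<u)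
  ∈-pairMonomial a′ s (u ∷ v ∷ []) (there (here refl)) (there (here refl)) _ v<v =
    ⊥-elim (FinP.<-irrefl refl v<v)
  ∈-pairMonomial a′ s (u ∷ v ∷ []) (here refl) (there (here refl)) _ u<v with u <? v
  ... | yes _  = here refl
  ... | no u≮v = ⊥-elim (u≮v u<v)
  ∈-pairMonomial a′ s (u ∷ v ∷ []) (there (here refl)) (here refl) _ v<u with u <? v
  ... | yes u<v = ⊥-elim (FinP.<-asym u<v v<u)
  ... | no _    = here refl

  -- One monomial per arrangement s of n − 2 values: φ of the filling with leg drop a′ s, arm
  -- take a′ s followed by the larger missing value, and the smaller missing value as corner.
  candidates : ℕ → ℕ → List (Mon n)
  candidates a′ j = concatMap (λ s → pairMonomial a′ s (complement s)) (arrangements j)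

  length-candidates : ∀ a′ j → length (candidates a′ j) ≤ length (arrangements j)
  length-candidates a′ j =
    length-concatMap≤ (λ s → pairMonomial a′ s (complement s)) (arrangements j) at-most-one
    where
    at-most-one : ∀ s → length (pairMonomial a′ s (complement s)) ≤ 1
    at-most-one s with complement s
    ... | []            = z≤n
    ... | _ ∷ []        = z≤n
    ... | _ ∷ _ ∷ []    = ℕP.≤-refl
    ... | _ ∷ _ ∷ _ ∷ _ = z≤n

  hookMonomial-∈-candidates : ∀ a′ j {c t s} → Unique s → length s ≡ j → n ∸ j ≡ 2 →
                              c ∉ s → t ∉ s → c Fin.< t →
                              hookMonomial c t (take a′ s) (drop a′ s) ∈ candidates a′ j
  hookMonomial-∈-candidates a′ j {s = s} us refl n∸j≡2 c∉s t∉s c<t =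
    ∈-concatMap⁺ (λ s → pairMonomial a′ s (complement s))
      (lose (∈-arrangements⁺ us)
        (∈-pairMonomial a′ s (complement s) (∈-complement⁺ c∉s) (∈-complement⁺ t∉s)
          (trans (length-complement s us) n∸j≡2) c<t))

module _ (a′ ℓ′ : ℕ) where

  private
    n : ℕ
    n = suc (a′ + suc ℓ′)

  hookSize∸2 : n ∸ (a′ + ℓ′) ≡ 2
  hookSize∸2 =
    trans (cong (λ m → suc m ∸ (a′ + ℓ′)) (ℕP.+-suc a′ ℓ′)) (ℕP.m+n∸n≡m 2 (a′ + ℓ′))

  shared-row⇒∈-candidates :
    ∀ {c t : Fin n} Y L R → length Y ≡ a′ → length L ≡ ℓ′ → length R ≡ suc a′ →
    Unique (c ∷ (Y ++ [ t ]) ++ L) → Unique R → (∀ v → rowExp (c ∷ Y ++ [ t ]) v ≡ rowExp R v) →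
    hookMonomial c t Y L ∈ candidates a′ (a′ + ℓ′)
  shared-row⇒∈-candidates {c} {t} Y L R lY lL lR distinct uR rowExp≗
    with Unique-middle⁻ (c ∷ Y) (subst (λ A → Unique (c ∷ A)) (ListP.++-assoc Y [ t ] L) distinct)
  ... | t∉cYL , c≢YL ∷ uYL =
    subst₂ (λ Y′ L′ → hookMonomial c t Y′ L′ ∈ candidates a′ (a′ + ℓ′))
      (subst (λ k → take k (Y ++ L) ≡ Y) lY (take-length-++ Y L))
      (subst (λ k → drop k (Y ++ L) ≡ L) lY (drop-length-++ Y L))
      (hookMonomial-∈-candidates a′ (a′ + ℓ′) uYL length-YL hookSize∸2
        (All¬⇒¬Any c≢YL) (t∉cYL ∘ there) c<t)
    where
    length-YL : length (Y ++ L) ≡ a′ + ℓ′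
    length-YL = trans (ListP.length-++ Y) (cong₂ _+_ lY lL)
    shorter : length R < length (c ∷ Y ++ [ t ])
    shorter = subst₂ _<_ (sym lR) (cong suc (sym (trans (ListP.length-++ Y) (cong (_+ 1) lY))))
                (s≤s (ℕP.m<m+n a′ (s≤s z≤n)))
    c<t : c Fin.< t
    c<t = row-first<last Y R (Unique-++⁻ˡ (c ∷ Y ++ [ t ]) distinct) uR rowExp≗ shorter

  φ-shared-∈-candidates : (S : HookFilling n (suc a′) ℓ′) (T : HookFilling n a′ (suc ℓ′)) →
                          φ S ≡ φ T → φ S ∈ candidates a′ (a′ + ℓ′)
  φ-shared-∈-candidates record { corner = c ; arm = arm ; leg = leg ; distinct = d } T φS≡φT
    with Vec.initLast arm
  ... | ys , t , refl =
    subst (_∈ candidates a′ (a′ + ℓ′)) (sym φS≡hook)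
      (shared-row⇒∈-candidates (toList ys) (toList leg) (HookFilling.row₁ T)
        (VecP.length-toList ys) (VecP.length-toList leg) (cong suc (VecP.length-toList (HookFilling.arm T)))
        (subst (λ A → Unique (c ∷ A ++ toList leg)) (VecP.toList-∷ʳ t ys) d)
        (Unique-++⁻ˡ (HookFilling.row₁ T) (HookFilling.distinct T))
        (tabulate-injective (cong proj₂ (trans (sym φS≡hook) φS≡φT))))
    where
    φS≡hook = φ-∷ʳ c ys t leg d

combo-support : ∀ {n α β} (L : List (ℚ × HookFilling n α β)) m → ¬ combo L m ≡ 0ℚ →
                ∃ λ (S : HookFilling n α β) → φ S ≡ m
combo-support [] m combo≢0 with () ← combo≢0 refl
combo-support ((_ , S) ∷ L) m combo≢0 with Mon-≟ (φ S) m
... | yes φS≡m = S , φS≡m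
... | no _     = combo-support L m (combo≢0 ∘ trans (+-identityˡ _))

InHook-support : ∀ {n α β f} → InHook n α β f → ∀ m → ¬ f m ≡ 0ℚ →
                 ∃ λ (S : HookFilling n α β) → φ S ≡ m
InHook-support (L , f≡combo) m f≢0 = combo-support L m (f≢0 ∘ trans (f≡combo m))

mainTheorem6 : (a ℓ : ℕ) → 2 ≤ a → 1 ≤ ℓ →
    (k : ℕ) (p : Fin k → Poly (a + ℓ ∸ 1)) →
    (∀ i → InHook (a + ℓ ∸ 1) (a ∸ 1) (ℓ ∸ 1) (p i)
    × InHook (a + ℓ ∸ 1) (a ∸ 2) ℓ (p i)) →
    LinIndep p →
    k ≤ (a + ℓ ∸ 1) ! / 2
mainTheorem6 (suc (suc a′)) (suc ℓ′) _ _ k p inBoth indep = begin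
  k                          ≤⟨ linIndep⇒≤length (candidates a′ j) p indep supported ⟩
  length (candidates a′ j)   ≤⟨ length-candidates a′ j ⟩
  length (arrangements j)    ≡⟨ sym (length-arrangements-∸2 j (hookSize∸2 a′ ℓ′)) ⟩
  suc (a′ + suc ℓ′) ! / 2    ∎
  where
  open ℕP.≤-Reasoning
  j = a′ + ℓ′
  supported : ∀ i → Supported (candidates a′ j) (p i)
  supported i m pᵢm≢0
    with InHook-support (proj₁ (inBoth i)) m pᵢm≢0 | InHook-support (proj₂ (inBoth i)) m pᵢm≢0
  ... | S , refl | T , φT≡φS = φ-shared-∈-candidates a′ ℓ′ S T (sym φT≡φS)
mainTheorem6 (suc zero) _ (s≤s ()) _ _ _ _ _
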